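{- Let $\Phi$ be a function on CP problems such that for each CP problem $(\mathcal{R}/\mathcal{S},L)$: if there are TRSs $\mathcal{R}_1,\mathcal{R}_2$ with $\mathcal{R}=\mathcal{R}_1\cup\mathcal{R}_2$ and a complexity pair $(\succ,\succsim)$ such that $\mathcal{R}_2\subseteq\succ$ and $\mathcal{R}_1\cup\mathcal{S}\subseteq\succsim$, then $\Phi(\mathcal{R}/\mathcal{S},L)=\{(\mathcal{R}_1/(\mathcal{R}_2\cup\mathcal{S}),L,f)\}$ for some such $\mathcal{R}_1,\mathcal{R}_2,(\succ,\succsim)$, where $f(n)=\mathrm{cp}(n,\succ,L)$; and otherwise $\Phi(\mathcal{R}/\mathcal{S},L)=\{(\mathcal{R}/\mathcal{S},L,\mathbf{0})\}$. Then $\Phi$ is a sound CP processor.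
   Context: A complexity pair $(\succ,\succsim)$ consists of two finitely branching rewrite relations (relations on terms closed under contexts and substitutions) with $\succsim\cdot\succ\subseteq\succ$ and $\succ\cdot\succsim\subseteq\succ$. $\to_{\mathcal{R}/\mathcal{S}}=\to_{\mathcal{S}}^*\cdot\to_{\mathcal{R}}\cdot\to_{\mathcal{S}}^*$; $\mathrm{dl}(t,\to)=\sup\{m\mid\exists u,\ t\to^mu\}$; $\mathrm{cp}(n,\to,L)=\sup\{\mathrm{dl}(t,\to)\mid t\in L,|t|\le n\}$. A CP problem is a pair $(\mathcal{R}/\mathcal{S},L)$ of a relative TRS and a set of terms $L$. A CP processor maps a CP problem to a finite set of triples $(\mathcal{R}_i/\mathcal{S}_i,L_i,f_i)$, $1\le i\le m$, with $(\mathcal{R}_i/\mathcal{S}_i,L_i)$ CP problems and $f_i:\mathbb{N}\to\mathbb{N}$. It is sound if for every input $(\mathcal{R}/\mathcal{S},L)$, $\mathrm{cp}(n,\to_{\mathcal{R}/\mathcal{S}},L)=O(f_1(n)+\dots+f_m(n)+\sum_i\mathrm{cp}(n,\to_{\mathcal{R}_i/\mathcal{S}_i},L_i))$. $\mathbf{0}$ is the constant zero function. -}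

module Defs where

open import Level using (Level; 0ℓ) renaming (suc to lsuc)
open import Data.Nat using (ℕ; zero; suc; _+_; _*_; _≤_)
open import Data.Fin using (Fin)
open import Data.Vec using (Vec; []; _∷_; _[_]≔_)
open import Data.List using (List; []; _∷_; _++_)
open import Data.List.Membership.Propositional using (_∈_)
open import Data.Product using (Σ; ∃; _×_; _,_)
open import Data.Sum using (_⊎_)
open import Data.Unit using (⊤)
open import Data.Empty using (⊥)
open import Relation.Nullary using (¬_)
open import Relation.Binary.PropositionalEquality using (_≡_)

record Signature : Set₁ where
  field
    Fun   : Set
    arity : Fun → ℕ
    Var   : Set
open Signature public

module _ (Sg : Signature) where

  data Term : Set where
    var : Var Sg → Term
    fun : (f : Fun Sg) → Vec Term (arity Sg f) → Term

  mutual
    size : Term → ℕ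
    size (var x)    = 1
    size (fun f ts) = suc (sizes ts)

    sizes : ∀ {k} → Vec Term k → ℕ
    sizes []       = 0
    sizes (t ∷ ts) = size t + sizes ts

  Subst : Set
  Subst = Var Sg → Term

  mutual
    _·_ : Term → Subst → Term
    var x    · σ = σ x
    fun f ts · σ = fun f (ts ·s σ)

    _·s_ : ∀ {k} → Vec Term k → Subst → Vec Term k
    []       ·s σ = []
    (t ∷ ts) ·s σ = (t · σ) ∷ (ts ·s σ)

  Rel : Set₁
  Rel = Term → Term → Set

  -- closure under contexts (single-hole contexts, built position by position)
  ClosedUnderContexts : Rel → Set
  ClosedUnderContexts _>_ =
    ∀ {s t} → s > t → (f : Fun Sg) (us : Vec Term (arity Sg f)) (i : Fin (arity Sg f)) →
      fun f (us [ i ]≔ s) > fun f (us [ i ]≔ t)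

  ClosedUnderSubst : Rel → Set
  ClosedUnderSubst _>_ = ∀ {s t} → s > t → (σ : Subst) → (s · σ) > (t · σ)

  FinitelyBranching : Rel → Set
  FinitelyBranching _>_ = ∀ s → Σ (List Term) λ ts → ∀ t → s > t → t ∈ ts

  record IsRewriteRelation (_>_ : Rel) : Set where
    field
      ctx    : ClosedUnderContexts _>_
      subst  : ClosedUnderSubst _>_
      finbr  : FinitelyBranching _>_

  _⊆ᴿ_ : Rel → Rel → Set
  A ⊆ᴿ B = ∀ {s t} → A s t → B s t

  _⨾_ : Rel → Rel → Rel
  (A ⨾ B) s u = Σ Term λ t → A s t × B t u

  record ComplexityPair : Set₁ where
    field
      _≻_  : Rel
      _≿_  : Rel
      ≻-rew : IsRewriteRelation _≻_
      ≿-rew : IsRewriteRelation _≿_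
      compatˡ : (_≿_ ⨾ _≻_) ⊆ᴿ _≻_
      compatʳ : (_≻_ ⨾ _≿_) ⊆ᴿ _≻_

  Rule : Set
  Rule = Term × Term

  TRS : Set
  TRS = List Rule

  data Step (R : TRS) : Rel where
    root : ∀ {l r} → (l , r) ∈ R → (σ : Subst) → Step R (l · σ) (r · σ)
    ctx  : ∀ {s t} → Step R s t → (f : Fun Sg) (us : Vec Term (arity Sg f)) (i : Fin (arity Sg f)) →
           Step R (fun f (us [ i ]≔ s)) (fun f (us [ i ]≔ t))

  data Star (A : Rel) : Rel where
    ε   : ∀ {s} → Star A s s
    _◅_ : ∀ {s t u} → A s t → Star A t u → Star A s u

  RelStep : TRS → TRS → Rel
  RelStep R S = Star (Step S) ⨾ (Step R ⨾ Star (Step S))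

  data Iter (A : Rel) : ℕ → Rel where
    zero : ∀ {s} → Iter A 0 s s
    suc  : ∀ {m s t u} → A s t → Iter A m t u → Iter A (suc m) s u

  -- dl(t, →) ≤ k   (dl is a supremum in ℕ ∪ {∞}; we only speak of its upper bounds)
  DlLe : Rel → Term → ℕ → Set
  DlLe A t k = ∀ m u → Iter A m t u → m ≤ k

  CpLe : Rel → (Term → Set) → ℕ → ℕ → Set
  CpLe A L n k = ∀ t → L t → size t ≤ n → DlLe A t k

  _⊆ʳ_ : TRS → Rel → Set
  R ⊆ʳ A = ∀ {l r} → (l , r) ∈ R → A l r

  _≐_∪_ : TRS → TRS → TRS → Set
  R ≐ R₁ ∪ R₂ = ∀ ρ → (ρ ∈ R → ρ ∈ R₁ ⊎ ρ ∈ R₂) × (ρ ∈ R₁ ⊎ ρ ∈ R₂ → ρ ∈ R)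

  record CPProblem : Set₁ where
    constructor _/_,_
    field
      Rr : TRS
      Ss : TRS
      Ll : Term → Set
  open CPProblem public

  -- An ℕ ∪ {∞}-valued function f is represented by its "upper bound"
  -- predicate:  Bound f n k  means  f(n) ≤ k.
  Bound : Set₁
  Bound = ℕ → ℕ → Set

  zeroB : Bound
  zeroB n k = ⊤

  cpB : Rel → (Term → Set) → Bound
  cpB A L n k = CpLe A L n k

  Triple : Set₁
  Triple = CPProblem × Bound

  -- AllBound n ts k : k = Σ_i (a_i + b_i) with f_i(n) ≤ a_i and
  --                    cp(n, →_{R_i/S_i}, L_i) ≤ b_i
  data AllBound (n : ℕ) : List Triple → ℕ → Set₁ where
    []  : AllBound n [] 0
    _∷_ : ∀ {R S L f ts a b k} →
          (f n a × CpLe (RelStep R S) L n b) → AllBound n ts k →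
          AllBound n (((R / S , L) , f) ∷ ts) (a + b + k)

  Processor : Set₁
  Processor = CPProblem → List Triple

  -- cp(n,→_{R/S},L) = O(f_1(n)+…+f_m(n)+Σ_i cp(n,→_{R_i/S_i},L_i))
  Sound : Processor → Set₁
  Sound Φ = ∀ P → Σ ℕ λ c → Σ ℕ λ N → ∀ n → N ≤ n → ∀ k →
            AllBound n (Φ P) k → CpLe (RelStep (Rr P) (Ss P)) (Ll P) n (c * k)

  record Decomp (R S R₁ R₂ : TRS) (C : ComplexityPair) : Set where
    open ComplexityPair C
    field
      split : R ≐ R₁ ∪ R₂
      R₂⊆≻  : R₂ ⊆ʳ _≻_
      R₁S⊆≿ : (R₁ ++ S) ⊆ʳ _≿_

  Decomposable : CPProblem → Set₁
  Decomposable P = Σ TRS λ R₁ → Σ TRS λ R₂ → Σ ComplexityPair λ C → Decomp (Rr P) (Ss P) R₁ R₂ C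

  Spec : Processor → Set₁
  Spec Φ = ∀ P →
    (Decomposable P →
       Σ TRS λ R₁ → Σ TRS λ R₂ → Σ ComplexityPair λ C →
         Decomp (Rr P) (Ss P) R₁ R₂ C ×
         Φ P ≡ (((R₁ / (R₂ ++ Ss P) , Ll P) , cpB (ComplexityPair._≻_ C) (Ll P)) ∷ []))
    × (¬ Decomposable P → Φ P ≡ ((P , zeroB) ∷ []))

-- Let R = R₁ ∪ R₂ with R₂ ⊆ ≻ and R₁ ∪ S ⊆ ≿.  Every →_{R/S} step
-- is either an R₁-step, hence an →_{R₁/(R₂∪S)} step and a ≿*-step, or an
-- R₂-step, hence a ≻-step (≿*·≻·≿* ⊆ ≻) and an →*_{R₂∪S} sequence.  Reading
-- an →_{R/S} derivation of length m from t backwards, the steps of the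
-- first kind are counted by an →_{R₁/(R₂∪S)} derivation from t and those of
-- the second kind by a ≻-derivation from t, because the remaining steps are
-- absorbed on the left (≿·≻ ⊆ ≻ and →_{R₂∪S}·→_{R₁/(R₂∪S)} ⊆ →_{R₁/(R₂∪S)}).
-- Hence dl(t,→_{R/S}) ≤ dl(t,→_{R₁/(R₂∪S)}) + dl(t,≻).
module Submission where

open import Defs
open import Data.Nat using (ℕ; suc; _+_; _*_; _≤_; _≤?_; s≤s; z≤n)
open import Data.Nat.Properties
  using (≤-trans; ≤-reflexive; m≤n+m; m≤m+n; +-mono-≤; +-comm; +-suc; +-identityʳ; *-identityˡ)
open import Data.List using ([]; _∷_; _++_)
open import Data.List.Membership.Propositional using (_∈_)
open import Data.List.Membership.Propositional.Properties using (∈-++⁺ˡ; ∈-++⁺ʳ)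
open import Data.Product using (∃; _×_; _,_; proj₁; proj₂)
open import Data.Sum using (_⊎_; inj₁; inj₂)
open import Relation.Nullary using (¬_; yes; no)
open import Relation.Nullary.Decidable using (decidable-stable; ¬¬-excluded-middle)
open import Relation.Binary.PropositionalEquality using (_≡_; subst; sym; trans)

module _ {Sg : Signature} where

  star-++ : ∀ {A : Rel Sg} {s t u} → Star Sg A s t → Star Sg A t u → Star Sg A s u
  star-++ ε       ys = ys
  star-++ (x ◅ xs) ys = x ◅ star-++ xs ys

  star-map : ∀ {A B : Rel Sg} → _⊆ᴿ_ Sg A B → _⊆ᴿ_ Sg (Star Sg A) (Star Sg B)
  star-map A⊆B ε        = ε
  star-map A⊆B (x ◅ xs) = A⊆B x ◅ star-map A⊆B xs

  absorbˡ : ∀ {X A : Rel Sg} → _⊆ᴿ_ Sg (_⨾_ Sg X A) A →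
            ∀ {s t u} → Star Sg X s t → A t u → A s u
  absorbˡ XA⊆A ε        a = a
  absorbˡ {X} {A} XA⊆A (x ◅ xs) a = XA⊆A (_ , x , absorbˡ {X} {A} XA⊆A xs a)

  absorbʳ : ∀ {A X : Rel Sg} → _⊆ᴿ_ Sg (_⨾_ Sg A X) A →
            ∀ {s t u} → A s t → Star Sg X t u → A s u
  absorbʳ AX⊆A a ε        = a
  absorbʳ {A} {X} AX⊆A a (x ◅ xs) = absorbʳ {A} {X} AX⊆A (AX⊆A (_ , a , x)) xs

  prepend : ∀ {X A : Rel Sg} → _⊆ᴿ_ Sg (_⨾_ Sg X A) A →
            ∀ {j s t} → Star Sg X s t → ∃ (Iter Sg A j t) → ∃ (Iter Sg A j s)
  prepend XA⊆A xs (_ , zero)       = _ , zero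
  prepend {X} {A} XA⊆A xs (_ , suc a rest) = _ , suc (absorbˡ {X} {A} XA⊆A xs a) rest

  record Cover (A B : Rel Sg) (m : ℕ) (t : Term Sg) : Set where
    field
      i j    : ℕ
      m≤i+j  : m ≤ i + j
      A-path : ∃ (Iter Sg A i t)
      B-path : ∃ (Iter Sg B j t)

  cover : ∀ {T A B X Y : Rel Sg} →
          _⊆ᴿ_ Sg (_⨾_ Sg X B) B → _⊆ᴿ_ Sg (_⨾_ Sg Y A) A →
          (∀ {s u} → T s u → (A s u × Star Sg X s u) ⊎ (B s u × Star Sg Y s u)) →
          ∀ {m t u} → Iter Sg T m t u → Cover A B m t
  cover XB⊆B YA⊆A classify zero =
    record { i = 0 ; j = 0 ; m≤i+j = z≤n ; A-path = _ , zero ; B-path = _ , zero }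
  cover XB⊆B YA⊆A classify (suc st rest) with classify st | cover XB⊆B YA⊆A classify rest
  ... | inj₁ (a , xs) | c = record
    { i = suc i ; j = j ; m≤i+j = s≤s m≤i+j
    ; A-path = _ , suc a (proj₂ A-path) ; B-path = prepend XB⊆B xs B-path }
    where open Cover c
  ... | inj₂ (b , ys) | c = record
    { i = i ; j = suc j ; m≤i+j = ≤-trans (s≤s m≤i+j) (≤-reflexive (sym (+-suc i j)))
    ; A-path = prepend YA⊆A ys A-path ; B-path = _ , suc b (proj₂ B-path) }
    where open Cover c

  cpLe-cover : ∀ {T A B : Rel Sg} {L n a b} →
               (∀ {m t u} → Iter Sg T m t u → Cover A B m t) →
               CpLe Sg A L n a → CpLe Sg B L n b → CpLe Sg T L n (a + b)
  cpLe-cover covered cpA cpB t t∈L |t|≤n m u deriv =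
    ≤-trans m≤i+j (+-mono-≤ (cpA t t∈L |t|≤n i _ (proj₂ A-path))
                            (cpB t t∈L |t|≤n j _ (proj₂ B-path)))
    where open Cover (covered deriv)

  cpLe-weaken : ∀ {A : Rel Sg} {L n k k'} → k ≤ k' → CpLe Sg A L n k → CpLe Sg A L n k'
  cpLe-weaken k≤k' cp t t∈L |t|≤n m u deriv = ≤-trans (cp t t∈L |t|≤n m u deriv) k≤k'

  -- Upper bounds on derivation lengths are ¬¬-stable, so they may be
  -- established by case analysis on an arbitrary (undecidable) proposition.
  cpLe-by-cases : ∀ {A : Rel Sg} {L n k} {P : Set₁} →
                  (P → CpLe Sg A L n k) → (¬ P → CpLe Sg A L n k) → CpLe Sg A L n k
  cpLe-by-cases onP on¬P t t∈L |t|≤n m u deriv =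
    decidable-stable (m ≤? _) λ m≰k → ¬¬-excluded-middle λ where
      (yes p) → m≰k (onP p t t∈L |t|≤n m u deriv)
      (no ¬p) → m≰k (on¬P ¬p t t∈L |t|≤n m u deriv)

  step⊆ : ∀ {A R} → IsRewriteRelation Sg A → _⊆ʳ_ Sg R A → _⊆ᴿ_ Sg (Step Sg R) A
  step⊆ rew R⊆A (root l→r σ)    = IsRewriteRelation.subst rew (R⊆A l→r) σ
  step⊆ rew R⊆A (ctx st f us i) = IsRewriteRelation.ctx rew (step⊆ rew R⊆A st) f us i

  step-mono : ∀ {R R'} → (∀ {ρ} → ρ ∈ R → ρ ∈ R') → _⊆ᴿ_ Sg (Step Sg R) (Step Sg R')
  step-mono R⊆R' (root l→r σ)    = root (R⊆R' l→r) σ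
  step-mono R⊆R' (ctx st f us i) = ctx (step-mono R⊆R' st) f us i

  step-split : ∀ {R R₁ R₂} → _≐_∪_ Sg R R₁ R₂ →
               ∀ {s t} → Step Sg R s t → Step Sg R₁ s t ⊎ Step Sg R₂ s t
  step-split split (root {l} {r} l→r σ) with proj₁ (split (l , r)) l→r
  ... | inj₁ ∈R₁ = inj₁ (root ∈R₁ σ)
  ... | inj₂ ∈R₂ = inj₂ (root ∈R₂ σ)
  step-split split (ctx st f us i) with step-split split st
  ... | inj₁ st₁ = inj₁ (ctx st₁ f us i)
  ... | inj₂ st₂ = inj₂ (ctx st₂ f us i)

  relStep-split : ∀ {R S R₁ R₂} → _≐_∪_ Sg R R₁ R₂ →
                  ∀ {s t} → RelStep Sg R S s t → RelStep Sg R₁ S s t ⊎ RelStep Sg R₂ S s t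
  relStep-split split (a , xs , b , st , ys) with step-split split st
  ... | inj₁ st₁ = inj₁ (a , xs , b , st₁ , ys)
  ... | inj₂ st₂ = inj₂ (a , xs , b , st₂ , ys)

  relStep-absorbs : ∀ {R S} → _⊆ᴿ_ Sg (_⨾_ Sg (Step Sg S) (RelStep Sg R S)) (RelStep Sg R S)
  relStep-absorbs (_ , x , (_ , xs , rest)) = _ , x ◅ xs , rest

  module _ {R S R₁ R₂ : TRS Sg} {C : ComplexityPair Sg} (D : Decomp Sg R S R₁ R₂ C) where
    open ComplexityPair C
    open Decomp D

    S-steps-≿ : ∀ {s t} → Star Sg (Step Sg S) s t → Star Sg _≿_ s t
    S-steps-≿ = star-map (λ st → step⊆ ≿-rew R₁S⊆≿ (step-mono (∈-++⁺ʳ R₁) st))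

    S-steps-R₂S : ∀ {s t} → Star Sg (Step Sg S) s t → Star Sg (Step Sg (R₂ ++ S)) s t
    S-steps-R₂S = star-map (step-mono (∈-++⁺ʳ R₂))

    ≻-between-≿ : ∀ {s t u v} → Star Sg _≿_ s t → t ≻ u → Star Sg _≿_ u v → s ≻ v
    ≻-between-≿ xs y zs = absorbʳ {_≻_} {_≿_} compatʳ (absorbˡ {_≿_} {_≻_} compatˡ xs y) zs

    classify : ∀ {s u} → RelStep Sg R S s u →
               (RelStep Sg R₁ (R₂ ++ S) s u × Star Sg _≿_ s u) ⊎
               (s ≻ u × Star Sg (Step Sg (R₂ ++ S)) s u)
    classify st with relStep-split split st
    ... | inj₁ (_ , xs , _ , st₁ , ys) = inj₁
      ( (_ , S-steps-R₂S xs , _ , st₁ , S-steps-R₂S ys)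
      , star-++ (S-steps-≿ xs) (step⊆ ≿-rew R₁S⊆≿ (step-mono ∈-++⁺ˡ st₁) ◅ S-steps-≿ ys) )
    ... | inj₂ (_ , xs , _ , st₂ , ys) = inj₂
      ( ≻-between-≿ (S-steps-≿ xs) (step⊆ ≻-rew R₂⊆≻ st₂) (S-steps-≿ ys)
      , star-++ (S-steps-R₂S xs) (step-mono ∈-++⁺ˡ st₂ ◅ S-steps-R₂S ys) )

    decomposition-sound : ∀ {L n k} →
      AllBound Sg n (((R₁ / (R₂ ++ S) , L) , cpB Sg _≻_ L) ∷ []) k → CpLe Sg (RelStep Sg R S) L n k
    decomposition-sound (_∷_ {a = a} {b = b} (cp≻ , cpR₁) []) =
      cpLe-weaken (≤-reflexive (trans (+-comm b a) (sym (+-identityʳ (a + b)))))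
        (cpLe-cover (cover compatˡ relStep-absorbs classify) cpR₁ cp≻)

  identity-sound : ∀ {R S L n k} →
    AllBound Sg n (((R / S , L) , zeroB Sg) ∷ []) k → CpLe Sg (RelStep Sg R S) L n k
  identity-sound (_∷_ {a = a} {b = b} (_ , cp) []) =
    cpLe-weaken (≤-trans (m≤n+m b a) (m≤m+n (a + b) 0)) cp

theorem7p3 : (Sg : Signature) (Φ : Processor Sg) → Spec Sg Φ → Sound Sg Φ
theorem7p3 Sg Φ spec P = 1 , 0 , sound
  where
    sound : ∀ n → 0 ≤ n → ∀ k → AllBound Sg n (Φ P) k →
            CpLe Sg (RelStep Sg (Rr P) (Ss P)) (Ll P) n (1 * k)
    sound n _ k bound =
      cpLe-weaken (≤-reflexive (sym (*-identityˡ k))) (cpLe-by-cases decomposable undecomposable)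
      where
        boundFor : ∀ {ts} → Φ P ≡ ts → AllBound Sg n ts k
        boundFor Φ≡ = subst (λ ts → AllBound Sg n ts k) Φ≡ bound

        decomposable : Decomposable Sg P → CpLe Sg (RelStep Sg (Rr P) (Ss P)) (Ll P) n k
        decomposable d with proj₁ (spec P) d
        ... | _ , _ , _ , D , Φ≡ = decomposition-sound D (boundFor Φ≡)

        undecomposable : ¬ Decomposable Sg P → CpLe Sg (RelStep Sg (Rr P) (Ss P)) (Ll P) n k
        undecomposable ¬d = identity-sound (boundFor (proj₂ (spec P) ¬d))
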